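{- Let $p$ be a prime. For all $d \in \{0, 1, \dots, p - 1\}$ and all $n \in \mathbb{Z}$, we have $A(d + p n) \equiv A(d) A(n) \pmod{p}$.
   Context: $A(z)$ denotes the Ap\'ery function, the entire function \[ A(z) = \sum_{k \geq 0} \frac{\Gamma(z + k + 1)^2}{\Gamma(z - k + 1)^2\, \Gamma(k + 1)^4} = \sum_{k\ge 0}\frac{(-z)_k^2\,(z+1)_k^2}{k!^4}, \] where $(x)_k = x(x+1)\cdots(x+k-1)$; each summand is a polynomial in $z$. For non-negative integers $n$, $A(n)=\sum_{k\ge0}\binom{n}{k}^2\binom{n+k}{k}^2$; for negative integers $n$, $A(n)$ is the value of this entire function, which satisfies $A(n)=A(-1-n)$ and hence is an integer. -}

module Defs where

open import Data.Nat using (ℕ; suc; _+_; _*_; _^_)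
open import Data.Nat.Combinatorics using (_C_)
open import Data.List using (map; upTo)
open import Data.Nat.ListAction using (sum)
open import Data.Integer using (ℤ; +_; -[1+_])

-- Apéry numbers for n ≥ 0:  A(n) = Σ_{k=0}^{n} C(n,k)^2 C(n+k,k)^2
-- (terms with k > n vanish, so summing over k ≤ n is the full sum).
apéryℕ : ℕ → ℕ
apéryℕ n = sum (map (λ k → ((n C k) ^ 2) * (((n + k) C k) ^ 2)) (upTo (suc n)))

-- For n ≥ 0 it is apéryℕ n;
-- for negative n = -(m+1) the entire function satisfies A(n) = A(-1-n) = A(m).
-- (Indeed the k-th summand at z = -(m+1) equals C(m+k,k)^2 C(m,k)^2.)
A : ℤ → ℤ
A (+ n)     = + apéryℕ n
A -[1+ m ]  = + apéryℕ m

{-# OPTIONS --safe #-}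
module Submission where

open import Defs

-- By Lucas' theorem C(d + mp, a + bp) ≡ C(d, a) C(m, b) (mod p) for digits d, a < p, and
-- likewise C(N + k, k) ≡ C(d + a, a) C(m + b, b) for N = d + mp, k = a + bp: if d + a ≥ p
-- there is a carry and both sides vanish.  Hence every Apéry term of d + mp is congruent
-- to the product of a term of d and a term of m, and cutting the Apéry sum of d + mp into
-- blocks k = a + bp factors it as A(d) A(m).  For n = -(m + 1) one has d + pn = -1 - (e + mp)
-- with e = p - 1 - d, so A(d + pn) = A(e + mp) ≡ A(e) A(m), and A(e) ≡ A(d) follows termwise
-- from C(p - 1 - d, a) ≡ (-1)^a C(d + a, a), valid for a < p.

module ApéryLucas where

  open import Data.Empty using (⊥-elim)
  open import Data.Integer as ℤ using (ℤ; +_; -[1+_]; -_; 0ℤ; 1ℤ; -1ℤ; _-_)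
  open import Data.Integer.Divisibility.Signed
    using (_∣_; divides; ∣ᵤ⇒∣; ∣m∣n⇒∣m+n; ∣m⇒∣-m; ∣n⇒∣m*n; ∣m⇒∣m*n)
  import Data.Integer.Properties as ℤ
  import Data.Integer.Tactic.RingSolver as ℤ-Ring
  open import Data.List using (map; applyUpTo)
  open import Data.Nat as ℕ
    using (ℕ; zero; suc; _+_; _*_; _^_; _∸_; _≤_; _<_; s≤s; z<s; s<s; s<s⁻¹; _<?_)
  open import Data.Nat.Combinatorics using (_C_; nCk+nC[k+1]≡[n+1]C[k+1]; k>n⇒nCk≡0; nCn≡1; nC1≡n)
  import Data.Nat.Divisibility as ℕ
  open import Data.Nat.ListAction using (sum)
  open import Data.Nat.Primality using (Prime; euclidsLemma)
  open import Data.Nat.Properties as ℕ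
    using (+-assoc; +-comm; +-identityʳ; *-identityˡ; *-zeroʳ; *-distribˡ-+; *-distribʳ-+;
           ≤-refl; <-trans; n<1+n; ≮⇒≥; m+[n∸m]≡n; m∸n+n≡m; m≤m+n; +-monoˡ-<; +-cancelʳ-<)
  open import Algebra.Properties.CommutativeSemigroup ℕ.+-commutativeSemigroup using (x∙yz≈y∙xz)
  open import Data.Nat.Solver using (module +-*-Solver)
  import Data.Nat.Tactic.RingSolver as ℕ-Ring
  open import Data.Sum using (inj₁; inj₂)
  open import Function.Base using (_∘_; id)
  open import Level using (0ℓ)
  open import Relation.Binary.Bundles using (Setoid)
  open import Relation.Binary.PropositionalEquality
  import Relation.Binary.Reasoning.Setoid as SetoidReasoning
  open import Relation.Nullary using (yes; no)

  private
    variable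
      m n k a b : ℕ
      x y z u v : ℤ

  -- Congruences

  infix 4 _≡_[mod_] _≡ⁿ_[mod_]

  record _≡_[mod_] (x y : ℤ) (m : ℕ) : Set where
    constructor mod-divides
    field
      ∣x-y : + m ∣ x - y

  open _≡_[mod_] public

  _≡ⁿ_[mod_] : ℕ → ℕ → ℕ → Set
  x ≡ⁿ y [mod m ] = + x ≡ + y [mod m ]

  ≡-mod-refl : x ≡ x [mod m ]
  ≡-mod-refl {x} = mod-divides (divides 0ℤ (ℤ.+-inverseʳ x))

  ≡-mod-reflexive : x ≡ y → x ≡ y [mod m ]
  ≡-mod-reflexive refl = ≡-mod-refl

  ≡-mod-sym : x ≡ y [mod m ] → y ≡ x [mod m ]
  ≡-mod-sym {x} {y} (mod-divides m∣x-y) = mod-divides (subst (_ ∣_) (swap x y) (∣m⇒∣-m m∣x-y))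
    where
    swap : ∀ x y → - (x - y) ≡ y - x
    swap = ℤ-Ring.solve-∀

  ≡-mod-trans : x ≡ y [mod m ] → y ≡ z [mod m ] → x ≡ z [mod m ]
  ≡-mod-trans {x} {y} {z = z} (mod-divides m∣x-y) (mod-divides m∣y-z) =
    mod-divides (subst (_ ∣_) (telescope x y z) (∣m∣n⇒∣m+n m∣x-y m∣y-z))
    where
    telescope : ∀ x y z → (x - y) ℤ.+ (y - z) ≡ x - z
    telescope = ℤ-Ring.solve-∀

  +-cong-mod : x ≡ y [mod m ] → u ≡ v [mod m ] → x ℤ.+ u ≡ y ℤ.+ v [mod m ]
  +-cong-mod {x} {y} {u = u} {v} (mod-divides m∣x-y) (mod-divides m∣u-v) =
    mod-divides (subst (_ ∣_) (regroup x y u v) (∣m∣n⇒∣m+n m∣x-y m∣u-v))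
    where
    regroup : ∀ x y u v → (x - y) ℤ.+ (u - v) ≡ (x ℤ.+ u) - (y ℤ.+ v)
    regroup = ℤ-Ring.solve-∀

  *-cong-mod : x ≡ y [mod m ] → u ≡ v [mod m ] → x ℤ.* u ≡ y ℤ.* v [mod m ]
  *-cong-mod {x} {y} {u = u} {v} (mod-divides m∣x-y) (mod-divides m∣u-v) =
    mod-divides (subst (_ ∣_) (regroup x y u v)
                       (∣m∣n⇒∣m+n (∣m⇒∣m*n u m∣x-y) (∣n⇒∣m*n y m∣u-v)))
    where
    regroup : ∀ x y u v → (x - y) ℤ.* u ℤ.+ y ℤ.* (u - v) ≡ x ℤ.* u - y ℤ.* v
    regroup = ℤ-Ring.solve-∀

  -‿cong-mod : x ≡ y [mod m ] → - x ≡ - y [mod m ]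
  -‿cong-mod {x} {y} (mod-divides m∣x-y) =
    mod-divides (subst (_ ∣_) (regroup x y) (∣m⇒∣-m m∣x-y))
    where
    regroup : ∀ x y → - (x - y) ≡ - x - - y
    regroup = ℤ-Ring.solve-∀

  ≡-mod-setoid : ℕ → Setoid 0ℓ 0ℓ
  ≡-mod-setoid m = record
    { Carrier       = ℤ
    ; _≈_           = _≡_[mod m ]
    ; isEquivalence = record { refl = ≡-mod-refl ; sym = ≡-mod-sym ; trans = ≡-mod-trans }
    }

  ≡ⁿ-mod-setoid : ℕ → Setoid 0ℓ 0ℓ
  ≡ⁿ-mod-setoid m = record
    { Carrier       = ℕ
    ; _≈_           = _≡ⁿ_[mod m ]
    ; isEquivalence = record { refl = ≡-mod-refl ; sym = ≡-mod-sym ; trans = ≡-mod-trans }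
    }

  ∣⇒≡ⁿ0-mod : m ℕ.∣ n → n ≡ⁿ 0 [mod m ]
  ∣⇒≡ⁿ0-mod {m} {n} m∣n =
    mod-divides (subst (+ m ∣_) (sym (ℤ.+-identityʳ (+ n))) (∣ᵤ⇒∣ m∣n))

  +-congⁿ-mod : a ≡ⁿ b [mod m ] → k ≡ⁿ n [mod m ] → a + k ≡ⁿ b + n [mod m ]
  +-congⁿ-mod {a} {b} {m} {k} {n} a≡b k≡n =
    subst₂ _≡_[mod m ] (sym (ℤ.pos-+ a k)) (sym (ℤ.pos-+ b n)) (+-cong-mod a≡b k≡n)

  *-congⁿ-mod : a ≡ⁿ b [mod m ] → k ≡ⁿ n [mod m ] → a * k ≡ⁿ b * n [mod m ]
  *-congⁿ-mod {a} {b} {m} {k} {n} a≡b k≡n =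
    subst₂ _≡_[mod m ] (sym (ℤ.pos-* a k)) (sym (ℤ.pos-* b n)) (*-cong-mod a≡b k≡n)

  ^2-congⁿ-mod : a ≡ⁿ b [mod m ] → a ^ 2 ≡ⁿ b ^ 2 [mod m ]
  ^2-congⁿ-mod a≡b = *-congⁿ-mod a≡b (*-congⁿ-mod a≡b ≡-mod-refl)

  -1^a*-1^a≡1 : ∀ a → -1ℤ ℤ.^ a ℤ.* -1ℤ ℤ.^ a ≡ 1ℤ
  -1^a*-1^a≡1 zero    = refl
  -1^a*-1^a≡1 (suc a) = trans (cancel-signs (-1ℤ ℤ.^ a)) (-1^a*-1^a≡1 a)
    where
    cancel-signs : ∀ s → (-1ℤ ℤ.* s) ℤ.* (-1ℤ ℤ.* s) ≡ s ℤ.* s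
    cancel-signs = ℤ-Ring.solve-∀

  pos-square : ∀ x → + (x ^ 2) ≡ + x ℤ.* + x
  pos-square x = trans (cong ℤ.+_ (cong (x *_) (ℕ.*-identityʳ x))) (ℤ.pos-* x x)

  ^2-cong-signed : ∀ a x y → -1ℤ ℤ.^ a ℤ.* + x ≡ + y [mod m ] → x ^ 2 ≡ⁿ y ^ 2 [mod m ]
  ^2-cong-signed {m} a x y ±x≡y = begin
    + (x ^ 2)                     ≡⟨ pos-square x ⟩
    + x ℤ.* + x                   ≡⟨ ℤ.*-identityˡ (+ x ℤ.* + x) ⟨
    1ℤ ℤ.* (+ x ℤ.* + x)          ≡⟨ cong (ℤ._* (+ x ℤ.* + x)) (-1^a*-1^a≡1 a) ⟨
    (s ℤ.* s) ℤ.* (+ x ℤ.* + x)   ≡⟨ regroup s (+ x) ⟩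
    (s ℤ.* + x) ℤ.* (s ℤ.* + x)   ≈⟨ *-cong-mod ±x≡y ±x≡y ⟩
    + y ℤ.* + y                   ≡⟨ pos-square y ⟨
    + (y ^ 2)                     ∎
    where
    open SetoidReasoning (≡-mod-setoid m)
    s = -1ℤ ℤ.^ a
    regroup : ∀ s x → (s ℤ.* s) ℤ.* (x ℤ.* x) ≡ (s ℤ.* x) ℤ.* (s ℤ.* x)
    regroup = ℤ-Ring.solve-∀

  -- Finite sums

  ∑< : ℕ → (ℕ → ℕ) → ℕ
  ∑< zero    f = 0
  ∑< (suc n) f = f 0 + ∑< n (f ∘ suc)

  infix 6.5 ∑<
  syntax ∑< n (λ i → e) = ∑[ i < n ] e

  sum-map-applyUpTo : ∀ (f g : ℕ → ℕ) n → sum (map f (applyUpTo g n)) ≡ ∑[ i < n ] f (g i)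
  sum-map-applyUpTo f g zero    = refl
  sum-map-applyUpTo f g (suc n) = cong (_+_ (f (g 0))) (sum-map-applyUpTo f (g ∘ suc) n)

  ∑-cong : ∀ {f g} n → (∀ i → f i ≡ g i) → ∑< n f ≡ ∑< n g
  ∑-cong zero    f≗g = refl
  ∑-cong (suc n) f≗g = cong₂ _+_ (f≗g 0) (∑-cong n (f≗g ∘ suc))

  ∑-cong-mod : ∀ {f g} n → (∀ i → i < n → f i ≡ⁿ g i [mod m ]) →
               ∑< n f ≡ⁿ ∑< n g [mod m ]
  ∑-cong-mod zero    f≡g = ≡-mod-refl
  ∑-cong-mod (suc n) f≡g =
    +-congⁿ-mod (f≡g 0 z<s) (∑-cong-mod n (λ i i<n → f≡g (suc i) (s<s i<n)))

  ∑-+ : ∀ f m n → ∑< (m + n) f ≡ ∑< m f + ∑[ i < n ] f (m + i)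
  ∑-+ f zero    n = refl
  ∑-+ f (suc m) n = trans (cong (_+_ (f 0)) (∑-+ (f ∘ suc) m n)) (sym (+-assoc (f 0) _ _))

  ∑-zero : ∀ n → ∑[ i < n ] 0 ≡ 0
  ∑-zero zero    = refl
  ∑-zero (suc n) = ∑-zero n

  ∑-extend : ∀ {f} → (∀ i → m ≤ i → f i ≡ 0) → m ≤ n → ∑< n f ≡ ∑< m f
  ∑-extend {m} {n} {f} f≡0 m≤n = begin
    ∑< n f                              ≡⟨ cong (λ k → ∑< k f) (m+[n∸m]≡n m≤n) ⟨
    ∑< (m + (n ∸ m)) f                  ≡⟨ ∑-+ f m (n ∸ m) ⟩
    ∑< m f + ∑[ i < n ∸ m ] f (m + i)   ≡⟨ cong (_+_ (∑< m f)) tail≡0 ⟩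
    ∑< m f + 0                          ≡⟨ +-identityʳ _ ⟩
    ∑< m f                              ∎
    where
    open ≡-Reasoning
    tail≡0 : ∑[ i < n ∸ m ] f (m + i) ≡ 0
    tail≡0 = trans (∑-cong (n ∸ m) (λ i → f≡0 (m + i) (m≤m+n m i))) (∑-zero (n ∸ m))

  ∑-*ˡ : ∀ f c n → ∑[ i < n ] c * f i ≡ c * ∑< n f
  ∑-*ˡ f c zero    = sym (*-zeroʳ c)
  ∑-*ˡ f c (suc n) =
    trans (cong (_+_ (c * f 0)) (∑-*ˡ (f ∘ suc) c n)) (sym (*-distribˡ-+ c (f 0) _))

  ∑-*ʳ : ∀ f c n → ∑[ i < n ] f i * c ≡ ∑< n f * c
  ∑-*ʳ f c zero    = refl
  ∑-*ʳ f c (suc n) =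
    trans (cong (_+_ (f 0 * c)) (∑-*ʳ (f ∘ suc) c n)) (sym (*-distribʳ-+ c (f 0) _))

  ∑-product : ∀ f g m n → ∑[ j < n ] ∑[ i < m ] f i * g j ≡ ∑< m f * ∑< n g
  ∑-product f g m n = begin
    ∑[ j < n ] ∑[ i < m ] f i * g j   ≡⟨ ∑-cong n (λ j → ∑-*ʳ f (g j) m) ⟩
    ∑[ j < n ] ∑< m f * g j           ≡⟨ ∑-*ˡ g (∑< m f) n ⟩
    ∑< m f * ∑< n g                   ∎
    where open ≡-Reasoning

  ∑-blocks : ∀ f r n → ∑< (n * r) f ≡ ∑[ b < n ] ∑[ a < r ] f (a + b * r)
  ∑-blocks f r zero    = refl
  ∑-blocks f r (suc n) = begin
    ∑< (r + n * r) f                                                 ≡⟨ ∑-+ f r (n * r) ⟩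
    ∑< r f + ∑[ i < n * r ] f (r + i)                                ≡⟨ cong₂ _+_ first other ⟩
    ∑[ a < r ] f (a + 0) + ∑[ b < n ] ∑[ a < r ] f (a + suc b * r)   ∎
    where
    open ≡-Reasoning
    first : ∑< r f ≡ ∑[ a < r ] f (a + 0)
    first = ∑-cong r (λ a → cong f (sym (+-identityʳ a)))
    other : ∑[ i < n * r ] f (r + i) ≡ ∑[ b < n ] ∑[ a < r ] f (a + suc b * r)
    other = trans (∑-blocks (λ i → f (r + i)) r n)
                  (∑-cong n (λ b → ∑-cong r (λ a → cong f (x∙yz≈y∙xz r a (b * r)))))

  -- Binomial coefficients

  pascal : ∀ n k → n C k + n C suc k ≡ suc n C suc k
  pascal = nCk+nC[k+1]≡[n+1]C[k+1]

  pascal-*ʳ : ∀ n k x → (n C k) * x + (n C suc k) * x ≡ (suc n C suc k) * x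
  pascal-*ʳ n k x = trans (sym (*-distribʳ-+ x (n C k) (n C suc k))) (cong (_* x) (pascal n k))

  pascal-mod : ∀ n k → n C k ≡ⁿ a [mod m ] → n C suc k ≡ⁿ b [mod m ] →
               suc n C suc k ≡ⁿ a + b [mod m ]
  pascal-mod n k nCk≡a nC[1+k]≡b =
    ≡-mod-trans (≡-mod-reflexive (cong ℤ.+_ (sym (pascal n k)))) (+-congⁿ-mod nCk≡a nC[1+k]≡b)

  absorption : ∀ n k → suc k * (suc n C suc k) ≡ suc n * (n C k)
  absorption zero    zero    = refl
  absorption zero    (suc k) = *-zeroʳ (suc (suc k))
  absorption (suc n) zero    =
    trans (+-identityʳ _) (trans (nC1≡n (suc (suc n))) (sym (ℕ.*-identityʳ (suc (suc n)))))
  absorption (suc n) (suc k) = begin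
    suc (suc k) * (suc (suc n) C suc (suc k))
      ≡⟨ cong (suc (suc k) *_) (pascal (suc n) (suc k)) ⟨
    suc (suc k) * (X + Y)
      ≡⟨ regroup k X Y ⟩
    X + suc k * X + suc (suc k) * Y
      ≡⟨ cong₂ (λ u v → X + u + v) (absorption n k) (absorption n (suc k)) ⟩
    X + suc n * (n C k) + suc n * (n C suc k)
      ≡⟨ +-assoc X _ _ ⟩
    X + (suc n * (n C k) + suc n * (n C suc k))
      ≡⟨ cong (_+_ X) (sym (*-distribˡ-+ (suc n) (n C k) _)) ⟩
    X + suc n * (n C k + n C suc k)
      ≡⟨ cong (λ t → X + suc n * t) (pascal n k) ⟩
    X + suc n * X
      ∎
    where
    open ≡-Reasoning
    X = suc n C suc k
    Y = suc n C suc (suc k)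
    regroup : ∀ k X Y → suc (suc k) * (X + Y) ≡ X + suc k * X + suc (suc k) * Y
    regroup = ℕ-Ring.solve-∀

  -- Apéry numbers

  apéryTerm : ℕ → ℕ → ℕ
  apéryTerm n k = (n C k) ^ 2 * ((n + k) C k) ^ 2

  apéryℕ-as-∑ : n < m → apéryℕ n ≡ ∑< m (apéryTerm n)
  apéryℕ-as-∑ {n} {m} n<m =
    trans (sum-map-applyUpTo (apéryTerm n) id (suc n)) (sym (∑-extend vanish n<m))
    where
    vanish : ∀ k → suc n ≤ k → apéryTerm n k ≡ 0
    vanish k n<k rewrite k>n⇒nCk≡0 n<k = refl

  negative-index : ∀ d e m → + d ℤ.+ + suc (d + e) ℤ.* -[1+ m ] ≡ -[1+ (e + m * suc (d + e)) ]
  negative-index d e m = trans (expand (+ d) (+ e) (+ m))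
    (cong (λ t → - (1ℤ ℤ.+ (+ e ℤ.+ t))) (sym (ℤ.pos-* m (suc (d + e)))))
    where
    expand : ∀ d e m → d ℤ.+ (1ℤ ℤ.+ (d ℤ.+ e)) ℤ.* - (1ℤ ℤ.+ m)
                     ≡ - (1ℤ ℤ.+ (e ℤ.+ m ℤ.* (1ℤ ℤ.+ (d ℤ.+ e))))
    expand = ℤ-Ring.solve-∀

  -- Binomial coefficients and Apéry numbers modulo a prime

  module _ {p-1 : ℕ} (p-prime : Prime (suc p-1)) where

    private
      p : ℕ
      p = suc p-1

    +≡p-1⇒< : ∀ a b → a + b ≡ p-1 → a < p
    +≡p-1⇒< a b a+b≡p-1 = s≤s (subst (a ≤_) a+b≡p-1 (m≤m+n a b))

    p∣pC[1+k] : suc k < p → p ℕ.∣ p C suc k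
    p∣pC[1+k] {k} 1+k<p with euclidsLemma (suc k) (p C suc k) p-prime
                               (ℕ.divides (p-1 C k) (trans (absorption p-1 k) (ℕ.*-comm p _)))
    ... | inj₁ p∣1+k     = ⊥-elim (ℕ.<⇒≱ 1+k<p (ℕ.∣⇒≤ p∣1+k))
    ... | inj₂ p∣pC[1+k] = p∣pC[1+k]

    -- Induction on d + m * p, lexicographically on (m, d); the digits of k and k - 1 are
    -- related definitionally because 0 + suc b * p reduces to suc (p-1 + b * p).
    lucas : ∀ d m a b → d < p → a < p → (d + m * p) C (a + b * p) ≡ⁿ (d C a) * (m C b) [mod p ]
    lucas zero    zero    zero    zero    _ _ = ≡-mod-refl
    lucas zero    zero    (suc a) b       _ _ = ≡-mod-refl
    lucas zero    zero    zero    (suc b) _ _ = ≡-mod-refl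
    lucas (suc d) m       zero    zero    _ _ = ≡-mod-refl
    lucas zero    (suc m) zero    zero    _ _ = ≡-mod-refl
    lucas (suc d) m (suc a) b 1+d<p 1+a<p = begin
      suc (d + m * p) C suc (a + b * p)
        ≈⟨ pascal-mod (d + m * p) (a + b * p)
                      (lucas d m a b d<p a<p) (lucas d m (suc a) b d<p 1+a<p) ⟩
      (d C a) * (m C b) + (d C suc a) * (m C b)
        ≡⟨ pascal-*ʳ d a (m C b) ⟩
      (suc d C suc a) * (m C b)
        ∎
      where
      open SetoidReasoning (≡ⁿ-mod-setoid p)
      d<p = <-trans (n<1+n d) 1+d<p
      a<p = <-trans (n<1+n a) 1+a<p
    lucas (suc d) m zero (suc b) 1+d<p 0<p = begin
      suc (d + m * p) C suc (p-1 + b * p)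
        ≈⟨ pascal-mod (d + m * p) (p-1 + b * p)
                      (lucas d m p-1 b d<p ≤-refl) (lucas d m zero (suc b) d<p 0<p) ⟩
      (d C p-1) * (m C b) + 1 * (m C suc b)
        ≡⟨ cong (λ c → c * (m C b) + 1 * (m C suc b)) (k>n⇒nCk≡0 (s<s⁻¹ 1+d<p)) ⟩
      1 * (m C suc b)
        ∎
      where
      open SetoidReasoning (≡ⁿ-mod-setoid p)
      d<p = <-trans (n<1+n d) 1+d<p
    lucas zero (suc m) (suc a) b _ 1+a<p = begin
      suc (p-1 + m * p) C suc (a + b * p)
        ≈⟨ pascal-mod (p-1 + m * p) (a + b * p)
                      (lucas p-1 m a b ≤-refl a<p) (lucas p-1 m (suc a) b ≤-refl 1+a<p) ⟩
      (p-1 C a) * (m C b) + (p-1 C suc a) * (m C b)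
        ≡⟨ pascal-*ʳ p-1 a (m C b) ⟩
      (p C suc a) * (m C b)
        ≈⟨ *-congⁿ-mod (∣⇒≡ⁿ0-mod (p∣pC[1+k] 1+a<p)) ≡-mod-refl ⟩
      0
        ∎
      where
      open SetoidReasoning (≡ⁿ-mod-setoid p)
      a<p = <-trans (n<1+n a) 1+a<p
    lucas zero (suc m) zero (suc b) _ 0<p = begin
      suc (p-1 + m * p) C suc (p-1 + b * p)
        ≈⟨ pascal-mod (p-1 + m * p) (p-1 + b * p)
                      (lucas p-1 m p-1 b ≤-refl ≤-refl) (lucas p-1 m zero (suc b) ≤-refl 0<p) ⟩
      (p-1 C p-1) * (m C b) + 1 * (m C suc b)
        ≡⟨ cong₂ _+_ (trans (cong (_* (m C b)) (nCn≡1 p-1)) (*-identityˡ _)) (*-identityˡ _) ⟩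
      m C b + m C suc b
        ≡⟨ pascal m b ⟩
      suc m C suc b
        ≡⟨ *-identityˡ _ ⟨
      1 * (suc m C suc b)
        ∎
      where open SetoidReasoning (≡ⁿ-mod-setoid p)

    lucas-vanishing : ∀ e m a b → e < a → a < p → (e + m * p) C (a + b * p) ≡ⁿ 0 [mod p ]
    lucas-vanishing e m a b e<a a<p = ≡-mod-trans (lucas e m a b (<-trans e<a a<p) a<p)
      (≡-mod-reflexive (cong (λ c → + (c * (m C b))) (k>n⇒nCk≡0 e<a)))

    -- The low digit c may exceed p; then there is a carry and both sides vanish.
    lucas-carry : ∀ c n a b → c < p + a → a < p →
                  (c + n * p) C (a + b * p) ≡ⁿ (c C a) * (n C b) [mod p ]
    lucas-carry c n a b c<p+a a<p with c <? p
    ... | yes c<p = lucas c n a b c<p a<p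
    ... | no  c≮p = begin
      (c + n * p) C (a + b * p)       ≡⟨ cong (λ t → (t + n * p) C (a + b * p)) e+p≡c ⟨
      (e + p + n * p) C (a + b * p)   ≡⟨ cong (_C (a + b * p)) (+-assoc e p (n * p)) ⟩
      (e + suc n * p) C (a + b * p)   ≈⟨ lucas-vanishing e (suc n) a b e<a a<p ⟩
      0 * (n C b)                     ≈⟨ *-congⁿ-mod cCa≡0 ≡-mod-refl ⟨
      (c C a) * (n C b)               ∎
      where
      open SetoidReasoning (≡ⁿ-mod-setoid p)
      e = c ∸ p
      e+p≡c : e + p ≡ c
      e+p≡c = m∸n+n≡m (≮⇒≥ c≮p)
      e<a : e < a
      e<a = +-cancelʳ-< p e a (subst₂ _<_ (sym e+p≡c) (+-comm p a) c<p+a)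
      cCa≡0 : c C a ≡ⁿ 0 [mod p ]
      cCa≡0 = subst₂ (λ t u → t C u ≡ⁿ 0 [mod p ])
                (trans (cong (_+_ e) (+-identityʳ p)) e+p≡c) (+-identityʳ a)
                (lucas-vanishing e 1 a 0 e<a a<p)

    binomial-reflection-p-1 : ∀ a → a < p → -1ℤ ℤ.^ a ℤ.* + (p-1 C a) ≡ 1ℤ [mod p ]
    binomial-reflection-p-1 zero    _     = ≡-mod-refl
    binomial-reflection-p-1 (suc a) 1+a<p = begin
      -1ℤ ℤ.* s ℤ.* + Y
        ≡⟨ alternate s (+ X) (+ Y) ⟩
      s ℤ.* + X - s ℤ.* + (X + Y)
        ≈⟨ +-cong-mod (binomial-reflection-p-1 a a<p) (-‿cong-mod s[X+Y]≡0) ⟩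
      1ℤ - s ℤ.* 0ℤ
        ≡⟨ annihilate s ⟩
      1ℤ
        ∎
      where
      open SetoidReasoning (≡-mod-setoid p)
      s = -1ℤ ℤ.^ a
      X = p-1 C a
      Y = p-1 C suc a
      a<p = <-trans (n<1+n a) 1+a<p
      s[X+Y]≡0 : s ℤ.* + (X + Y) ≡ s ℤ.* 0ℤ [mod p ]
      s[X+Y]≡0 = *-cong-mod (≡-mod-refl {x = s})
        (subst (_≡ⁿ 0 [mod p ]) (sym (pascal p-1 a)) (∣⇒≡ⁿ0-mod (p∣pC[1+k] 1+a<p)))
      alternate : ∀ s x y → -1ℤ ℤ.* s ℤ.* y ≡ s ℤ.* x - s ℤ.* (x ℤ.+ y)
      alternate = ℤ-Ring.solve-∀
      annihilate : ∀ s → 1ℤ - s ℤ.* 0ℤ ≡ 1ℤ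
      annihilate = ℤ-Ring.solve-∀

    -- The integer form of C(-1 - d, a) = (-1)^a C(d + a, a), as p - 1 - d ≡ -1 - d.
    binomial-reflection : ∀ d e a → d + e ≡ p-1 → a < p →
                          -1ℤ ℤ.^ a ℤ.* + (e C a) ≡ + ((d + a) C a) [mod p ]
    binomial-reflection zero    e a refl a<p =
      ≡-mod-trans (binomial-reflection-p-1 a a<p) (≡-mod-reflexive (cong ℤ.+_ (sym (nCn≡1 a))))
    binomial-reflection (suc d) e zero    _ _ = ≡-mod-refl
    binomial-reflection (suc d) e (suc a) 1+d+e≡p-1 1+a<p = begin
      -1ℤ ℤ.* s ℤ.* + (e C suc a)
        ≡⟨ alternate s (+ (e C a)) (+ (e C suc a)) ⟩
      -1ℤ ℤ.* s ℤ.* + (e C a + e C suc a) ℤ.+ s ℤ.* + (e C a)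
        ≡⟨ cong (λ t → -1ℤ ℤ.* s ℤ.* + t ℤ.+ s ℤ.* + (e C a)) (pascal e a) ⟩
      -1ℤ ℤ.^ suc a ℤ.* + (suc e C suc a) ℤ.+ s ℤ.* + (e C a)
        ≈⟨ +-cong-mod (binomial-reflection d (suc e) (suc a) d+1+e≡p-1 1+a<p)
                      (binomial-reflection (suc d) e a 1+d+e≡p-1 (<-trans (n<1+n a) 1+a<p)) ⟩
      + ((d + suc a) C suc a) ℤ.+ + ((suc d + a) C a)
        ≡⟨ cong ℤ.+_ pascal-diagonal ⟩
      + ((suc d + suc a) C suc a)
        ∎
      where
      open SetoidReasoning (≡-mod-setoid p)
      s = -1ℤ ℤ.^ a
      d+1+e≡p-1 : d + suc e ≡ p-1
      d+1+e≡p-1 = trans (ℕ.+-suc d e) 1+d+e≡p-1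
      alternate : ∀ s x y → -1ℤ ℤ.* s ℤ.* y ≡ -1ℤ ℤ.* s ℤ.* (x ℤ.+ y) ℤ.+ s ℤ.* x
      alternate = ℤ-Ring.solve-∀
      pascal-diagonal : (d + suc a) C suc a + (suc d + a) C a ≡ (suc d + suc a) C suc a
      pascal-diagonal rewrite ℕ.+-suc d a =
        trans (+-comm (suc (d + a) C suc a) _) (pascal (suc (d + a)) a)

    apéryTerm-lucas : ∀ d m a b → d < p → a < p →
                      apéryTerm (d + m * p) (a + b * p) ≡ⁿ apéryTerm d a * apéryTerm m b [mod p ]
    apéryTerm-lucas d m a b d<p a<p = begin
      ((d + m * p) C j) ^ 2 * ((d + m * p + j) C j) ^ 2
        ≈⟨ *-congⁿ-mod (^2-congⁿ-mod (lucas d m a b d<p a<p)) (^2-congⁿ-mod diagonal) ⟩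
      ((d C a) * (m C b)) ^ 2 * (((d + a) C a) * ((m + b) C b)) ^ 2
        ≡⟨ interchange (d C a) (m C b) ((d + a) C a) ((m + b) C b) ⟩
      apéryTerm d a * apéryTerm m b
        ∎
      where
      open SetoidReasoning (≡ⁿ-mod-setoid p)
      open +-*-Solver
      j = a + b * p
      regroup : ∀ d m a b p → d + a + (m + b) * p ≡ d + m * p + (a + b * p)
      regroup = ℕ-Ring.solve-∀
      diagonal : (d + m * p + j) C j ≡ⁿ ((d + a) C a) * ((m + b) C b) [mod p ]
      diagonal = subst (λ t → t C j ≡ⁿ ((d + a) C a) * ((m + b) C b) [mod p ]) (regroup d m a b p)
                   (lucas-carry (d + a) (m + b) a b (+-monoˡ-< a d<p) a<p)
      interchange : ∀ x y z w → (x * y) ^ 2 * (z * w) ^ 2 ≡ (x ^ 2 * z ^ 2) * (y ^ 2 * w ^ 2)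
      interchange = solve 4 (λ x y z w → (x :* y) :^ 2 :* (z :* w) :^ 2
                                       := (x :^ 2 :* z :^ 2) :* (y :^ 2 :* w :^ 2)) refl

    apéryTerm-reflection : ∀ d e a → d + e ≡ p-1 → a < p →
                           apéryTerm e a ≡ⁿ apéryTerm d a [mod p ]
    apéryTerm-reflection d e a d+e≡p-1 a<p = begin
      (e C a) ^ 2 * ((e + a) C a) ^ 2
        ≈⟨ *-congⁿ-mod (^2-cong-signed a _ _ (binomial-reflection d e a d+e≡p-1 a<p))
                       (≡-mod-sym (^2-cong-signed a _ _ (binomial-reflection e d a e+d≡p-1 a<p))) ⟩
      ((d + a) C a) ^ 2 * (d C a) ^ 2
        ≡⟨ ℕ.*-comm (((d + a) C a) ^ 2) _ ⟩
      apéryTerm d a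
        ∎
      where
      open SetoidReasoning (≡ⁿ-mod-setoid p)
      e+d≡p-1 = trans (+-comm e d) d+e≡p-1

    apéry-lucas : ∀ d m → d < p → apéryℕ (d + m * p) ≡ⁿ apéryℕ d * apéryℕ m [mod p ]
    apéry-lucas d m d<p = begin
      apéryℕ N
        ≡⟨ apéryℕ-as-∑ (+-monoˡ-< (m * p) d<p) ⟩
      ∑< (suc m * p) (apéryTerm N)
        ≡⟨ ∑-blocks (apéryTerm N) p (suc m) ⟩
      ∑[ b < suc m ] ∑[ a < p ] apéryTerm N (a + b * p)
        ≈⟨ ∑-cong-mod (suc m) (λ b _ → ∑-cong-mod p (λ a a<p →
             apéryTerm-lucas d m a b d<p a<p)) ⟩
      ∑[ b < suc m ] ∑[ a < p ] apéryTerm d a * apéryTerm m b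
        ≡⟨ ∑-product (apéryTerm d) (apéryTerm m) p (suc m) ⟩
      ∑< p (apéryTerm d) * ∑< (suc m) (apéryTerm m)
        ≡⟨ cong₂ _*_ (apéryℕ-as-∑ d<p) (apéryℕ-as-∑ (n<1+n m)) ⟨
      apéryℕ d * apéryℕ m
        ∎
      where
      open SetoidReasoning (≡ⁿ-mod-setoid p)
      N = d + m * p

    apéry-reflection : ∀ d e → d + e ≡ p-1 → apéryℕ e ≡ⁿ apéryℕ d [mod p ]
    apéry-reflection d e d+e≡p-1 = begin
      apéryℕ e             ≡⟨ apéryℕ-as-∑ (+≡p-1⇒< e d (trans (+-comm e d) d+e≡p-1)) ⟩
      ∑< p (apéryTerm e)   ≈⟨ ∑-cong-mod p (λ a a<p → apéryTerm-reflection d e a d+e≡p-1 a<p) ⟩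
      ∑< p (apéryTerm d)   ≡⟨ apéryℕ-as-∑ (+≡p-1⇒< d e d+e≡p-1) ⟨
      apéryℕ d             ∎
      where open SetoidReasoning (≡ⁿ-mod-setoid p)

    A-lucas : ∀ d → d < p → ∀ n → A (+ d ℤ.+ + p ℤ.* n) ≡ A (+ d) ℤ.* A n [mod p ]
    A-lucas d d<p (+ m) =
      subst₂ _≡_[mod p ] (cong A (sym index)) (ℤ.pos-* (apéryℕ d) (apéryℕ m)) (apéry-lucas d m d<p)
      where
      index : + d ℤ.+ + p ℤ.* + m ≡ + (d + m * p)
      index = cong (ℤ._+_ (+ d)) (trans (sym (ℤ.pos-* p m)) (cong ℤ.+_ (ℕ.*-comm p m)))
    A-lucas d d<p -[1+ m ] =
      subst₂ _≡_[mod p ] (cong A (sym index)) (ℤ.pos-* (apéryℕ d) (apéryℕ m))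
        (≡-mod-trans (apéry-lucas e m e<p) (*-congⁿ-mod (apéry-reflection d e d+e≡p-1) ≡-mod-refl))
      where
      e = p-1 ∸ d
      d+e≡p-1 : d + e ≡ p-1
      d+e≡p-1 = m+[n∸m]≡n (ℕ.≤-pred d<p)
      e<p : e < p
      e<p = +≡p-1⇒< e d (trans (+-comm e d) d+e≡p-1)
      index : + d ℤ.+ + p ℤ.* -[1+ m ] ≡ -[1+ (e + m * p) ]
      index = subst (λ r → + d ℤ.+ + suc r ℤ.* -[1+ m ] ≡ -[1+ (e + m * suc r) ]) d+e≡p-1
                    (negative-index d e m)

open import Data.Nat using (ℕ; suc; _<_)
open import Data.Nat.Primality using (Prime)
open import Data.Integer using (ℤ; +_; _+_; _*_; _-_)
open import Data.Integer.Divisibility using (_∣_)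
open import Data.Integer.Divisibility.Signed using (∣⇒∣ᵤ)
open ApéryLucas using (A-lucas; ∣x-y)

theorem4 : (p : ℕ) → Prime p → (d : ℕ) → d < p → (n : ℤ) →
    (+ p) ∣ (A (+ d + + p * n) - A (+ d) * A n)
theorem4 (suc p-1) p-prime d d<p n = ∣⇒∣ᵤ (∣x-y (A-lucas p-prime d d<p n))
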